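{- Let $L$ be an algebraically closed field, let $\varphi\in L(T)$ be a rational map of degree $d\ge2$, and let $F=(F_1,F_2)$ be a homogeneous lifting of $\varphi$. Then the natural map (sending $z$ to its class in $\mathbb{P}^1(L)$) from the set of preperiodic points of $F$ in $L^2\setminus\{0\}$ to the set of preperiodic points of $\varphi$ in $\mathbb{P}^1(L)$ is surjective.
   Context: A homogeneous lifting of $\varphi$ is $F=(F_1,F_2)$, $F_i\in L[X,Y]$ homogeneous of degree $d$ with no common linear factor, such that $\varphi([z_0:z_1])=[F_1(z_0,z_1):F_2(z_0,z_1)]$; $F$ is viewed as a map $L^2\to L^2$. A point is preperiodic for a map if its forward orbit under iteration of that map is finite. -}

module Defs where

open import Level using (Level; _⊔_)
open import Algebra.Bundles using (CommutativeRing)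
open import Data.Nat using (ℕ; zero; suc; _<_)
open import Data.List using (List; []; _∷_; _++_; [_])
open import Data.Vec using (Vec; []; _∷_; map; zipWith; _∷ʳ_)
open import Data.Vec.Relation.Binary.Pointwise.Inductive using (Pointwise)
open import Data.Product using (Σ; ∃; _×_; _,_)
open import Data.Empty using (⊥)
open import Relation.Nullary using (¬_)
open import Function using (_∘_)

module _ {c ℓ : Level} (R : CommutativeRing c ℓ) where
  open CommutativeRing R

  pow : Carrier → ℕ → Carrier
  pow x zero = 1#
  pow x (suc n) = x * pow x n

  record IsField : Set (c ⊔ ℓ) where
    field
      0≉1 : ¬ (0# ≈ 1#)
      inverse : ∀ x → ¬ (x ≈ 0#) → Σ Carrier λ y → x * y ≈ 1#

  -- one-variable polynomials as coefficient lists, lowest degree first (Horner evaluation)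
  evalPoly : List Carrier → Carrier → Carrier
  evalPoly [] x = 0#
  evalPoly (a ∷ as) x = a + x * evalPoly as x

  -- algebraically closed: every polynomial a0 + ... + c X^k with k ≥ 1 and c ≠ 0 has a root
  IsAlgClosed : Set (c ⊔ ℓ)
  IsAlgClosed = ∀ (a₀ : Carrier) (as : List Carrier) (lead : Carrier) → ¬ (lead ≈ 0#) →
    Σ Carrier λ x → evalPoly (a₀ ∷ (as ++ [ lead ])) x ≈ 0#

  -- A homogeneous form of degree d in L[X,Y] is given by its coefficient vector
  -- (a₀ , … , a_d), representing Σ aᵢ Xⁱ Y^(d-i).
  HForm : ℕ → Set c
  HForm d = Vec Carrier (suc d)

  evalH : ∀ {d} → HForm d → Carrier → Carrier → Carrier
  evalH {zero} (a ∷ []) x y = a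
  evalH {suc d} (a ∷ as) x y = a * pow y (suc d) + x * evalH as x y

  -- product of the linear form aX + bY with a form of degree m-1 (coefficient vector of
  -- length m), giving the coefficient vector (length m+1) of the product
  mulLin : ∀ {m} → Carrier → Carrier → Vec Carrier m → Vec Carrier (suc m)
  mulLin a b g = zipWith _+_ (map (b *_) g ∷ʳ 0#) (0# ∷ map (a *_) g)

  LinDivides : ∀ {d} → Carrier → Carrier → HForm d → Set (c ⊔ ℓ)
  LinDivides {d} a b F = Σ (Vec Carrier d) λ G → Pointwise _≈_ F (mulLin a b G)

  NoCommonLinearFactor : ∀ {d} → HForm d → HForm d → Set (c ⊔ ℓ)
  NoCommonLinearFactor F₁ F₂ = ¬ (Σ Carrier λ a → Σ Carrier λ b →
    ¬ (a ≈ 0# × b ≈ 0#) × LinDivides a b F₁ × LinDivides a b F₂)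

  L² : Set c
  L² = Carrier × Carrier

  _≈₂_ : L² → L² → Set ℓ
  (x , y) ≈₂ (x' , y') = (x ≈ x') × (y ≈ y')

  NonZero₂ : L² → Set ℓ
  NonZero₂ (x , y) = ¬ (x ≈ 0# × y ≈ 0#)

  _∼ₚ_ : L² → L² → Set (c ⊔ ℓ)
  (x , y) ∼ₚ (x' , y') = Σ Carrier λ t → ¬ (t ≈ 0#) × ((x' ≈ t * x) × (y' ≈ t * y))

  liftMap : ∀ {d} → HForm d → HForm d → L² → L²
  liftMap F₁ F₂ (x , y) = (evalH F₁ x y , evalH F₂ x y)

  iter : ∀ {A : Set c} → (A → A) → ℕ → A → A
  iter f zero a = a
  iter f (suc n) a = f (iter f n a)

  PreperiodicLift : ∀ {d} → HForm d → HForm d → L² → Set ℓ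
  PreperiodicLift F₁ F₂ z = Σ ℕ λ m → Σ ℕ λ n → m < n ×
    (iter (liftMap F₁ F₂) m z ≈₂ iter (liftMap F₁ F₂) n z)

  -- φ([z₀:z₁]) = [F₁(z₀,z₁) : F₂(z₀,z₁)], so φⁿ([z]) = [Fⁿ(z)].
  -- [z] is preperiodic for φ : its forward orbit in P¹(L) is finite, i.e. some
  -- iterate repeats as a point of P¹(L)
  PreperiodicP¹ : ∀ {d} → HForm d → HForm d → L² → Set (c ⊔ ℓ)
  PreperiodicP¹ F₁ F₂ z = Σ ℕ λ m → Σ ℕ λ n → m < n ×
    (iter (liftMap F₁ F₂) m z ∼ₚ iter (liftMap F₁ F₂) n z)

-- If Fⁿ(z) = t·Fᵐ(z) with m < n, homogeneity of degree d gives Fʲ(r·z) = r^(dʲ)·Fʲ(z), so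
-- Fᵐ(r·z) = Fⁿ(r·z) as soon as r^(dⁿ - dᵐ)·t = 1.  Since dⁿ > dᵐ, such an r is a root of
-- t·X^(dⁿ - dᵐ) - 1, which exists by algebraic closedness; it is a unit, so r·z ≠ 0 and
-- [r·z] = [z].

module Submission where

open import Defs
open import Level using (Level)
open import Algebra.Bundles using (CommutativeRing)
open import Data.Nat using (ℕ; _≤_)
open import Data.Product using (Σ; _×_)

open import Data.Nat as ℕ using (zero; suc)
import Data.Nat.Properties as ℕₚ
open import Data.List using (_++_; [_]; replicate)
open import Data.Vec using ([]; _∷_)
open import Data.Product using (_,_; proj₁; proj₂)
open import Data.Product.Relation.Binary.Pointwise.NonDependent using (×-setoid)
open import Relation.Nullary using (¬_)
open import Relation.Binary.PropositionalEquality
  using (_≡_; cong) renaming (refl to ≡-refl; trans to ≡-trans)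
import Relation.Binary.Reasoning.Setoid as SetoidReasoning
import Algebra.Properties.CommutativeSemiring.Exp as ExpProperties
import Algebra.Properties.CommutativeSemigroup as CommutativeSemigroupProperties
import Algebra.Properties.Ring as RingProperties

module Scalars {c ℓ : Level} (R : CommutativeRing c ℓ) where
  open CommutativeRing R
  open ExpProperties commutativeSemiring using (_^_; ^-distrib-*; ^-homo-*)
  open CommutativeSemigroupProperties *-commutativeSemigroup using (interchange; x∙yz≈y∙xz)
  open RingProperties ring using (+-inverseʳ-unique; -‿involutive)
  open SetoidReasoning setoid

  pow≡^ : ∀ x n → pow R x n ≡ x ^ n
  pow≡^ x zero = ≡-refl
  pow≡^ x (suc n) = cong (x *_) (pow≡^ x n)

  evalH-cong : ∀ {d} (F : HForm R d) {x x′ y y′} → x ≈ x′ → y ≈ y′ →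
    evalH R F x y ≈ evalH R F x′ y′
  evalH-cong {zero} (a ∷ []) x≈x′ y≈y′ = refl
  evalH-cong {suc d} (a ∷ as) x≈x′ y≈y′ =
    +-cong (*-congˡ (pow-cong (suc d) y≈y′)) (*-cong x≈x′ (evalH-cong as x≈x′ y≈y′))
    where
    pow-cong : ∀ {u v} k → u ≈ v → pow R u k ≈ pow R v k
    pow-cong zero u≈v = refl
    pow-cong (suc k) u≈v = *-cong u≈v (pow-cong k u≈v)

  evalH-homogeneous : ∀ {d} (F : HForm R d) a x y →
    evalH R F (a * x) (a * y) ≈ a ^ d * evalH R F x y
  evalH-homogeneous {zero} (b ∷ []) a x y = sym (*-identityˡ b)
  evalH-homogeneous {suc d} (b ∷ as) a x y = begin
    b * pow R (a * y) (suc d) + a * x * evalH R as (a * x) (a * y)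
      ≡⟨ cong (λ p → b * p + a * x * evalH R as (a * x) (a * y)) (pow≡^ (a * y) (suc d)) ⟩
    b * (a * y) ^ suc d + a * x * evalH R as (a * x) (a * y)
      ≈⟨ +-cong (*-congˡ (^-distrib-* a y (suc d))) (*-congˡ (evalH-homogeneous as a x y)) ⟩
    b * (a ^ suc d * y ^ suc d) + a * x * (a ^ d * E)
      ≈⟨ +-cong (x∙yz≈y∙xz b _ _) (interchange a x (a ^ d) E) ⟩
    a ^ suc d * (b * y ^ suc d) + a ^ suc d * (x * E)
      ≈⟨ distribˡ (a ^ suc d) _ _ ⟨
    a ^ suc d * (b * y ^ suc d + x * E)
      ≡⟨ cong (λ p → a ^ suc d * (b * p + x * E)) (pow≡^ y (suc d)) ⟨
    a ^ suc d * (b * pow R y (suc d) + x * E) ∎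
    where E = evalH R as x y

  ^-shift : ∀ r t i k {j} → i ℕ.+ k ≡ j → r ^ k * t ≈ 1# → r ^ i ≈ r ^ j * t
  ^-shift r t i k {j} i+k≡j rᵏt≈1 = sym (begin
    r ^ j * t             ≡⟨ cong (λ e → r ^ e * t) i+k≡j ⟨
    r ^ (i ℕ.+ k) * t     ≈⟨ *-congʳ (^-homo-* r i k) ⟩
    r ^ i * r ^ k * t     ≈⟨ *-assoc (r ^ i) (r ^ k) t ⟩
    r ^ i * (r ^ k * t)   ≈⟨ *-congˡ rᵏt≈1 ⟩
    r ^ i * 1#            ≈⟨ *-identityʳ (r ^ i) ⟩
    r ^ i ∎)

  unit-cancel : ∀ {a b u} → a * b ≈ 1# → a * u ≈ 0# → u ≈ 0#
  unit-cancel {a} {b} {u} ab≈1 au≈0 = begin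
    u           ≈⟨ *-identityˡ u ⟨
    1# * u      ≈⟨ *-congʳ ab≈1 ⟨
    a * b * u   ≈⟨ *-congʳ (*-comm a b) ⟩
    b * a * u   ≈⟨ *-assoc b a u ⟩
    b * (a * u) ≈⟨ *-congˡ au≈0 ⟩
    b * 0#      ≈⟨ zeroʳ b ⟩
    0# ∎

  unit-≉0 : ¬ (0# ≈ 1#) → ∀ {a b} → a * b ≈ 1# → ¬ (a ≈ 0#)
  unit-≉0 0≉1 {a} {b} ab≈1 a≈0 = 0≉1 (begin
    0#      ≈⟨ zeroˡ b ⟨
    0# * b  ≈⟨ *-congʳ a≈0 ⟨
    a * b   ≈⟨ ab≈1 ⟩
    1# ∎)

  evalPoly-monomial : ∀ k a x → evalPoly R (replicate k 0# ++ [ a ]) x ≈ x ^ k * a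
  evalPoly-monomial zero a x = begin
    a + x * 0#  ≈⟨ +-congˡ (zeroʳ x) ⟩
    a + 0#      ≈⟨ +-identityʳ a ⟩
    a           ≈⟨ *-identityˡ a ⟨
    1# * a ∎
  evalPoly-monomial (suc k) a x = begin
    0# + x * evalPoly R (replicate k 0# ++ [ a ]) x ≈⟨ +-identityˡ _ ⟩
    x * evalPoly R (replicate k 0# ++ [ a ]) x      ≈⟨ *-congˡ (evalPoly-monomial k a x) ⟩
    x * (x ^ k * a)                                 ≈⟨ *-assoc x (x ^ k) a ⟨
    x ^ suc k * a ∎

  ∃-root-of-inverse : IsAlgClosed R → ∀ k {a} → ¬ (a ≈ 0#) → Σ Carrier λ r → r ^ suc k * a ≈ 1#
  ∃-root-of-inverse closed k {a} a≉0 with closed (- 1#) (replicate k 0#) a a≉0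
  ... | r , root = r , (begin
    r ^ suc k * a   ≈⟨ *-assoc r (r ^ k) a ⟩
    r * (r ^ k * a) ≈⟨ *-congˡ (evalPoly-monomial k a r) ⟨
    r * evalPoly R (replicate k 0# ++ [ a ]) r ≈⟨ +-inverseʳ-unique (- 1#) _ root ⟩
    - - 1#          ≈⟨ -‿involutive 1# ⟩
    1# ∎)

module Points {c ℓ : Level} (R : CommutativeRing c ℓ) where
  open CommutativeRing R
    using (Carrier; _≈_; _*_; 1#; setoid; commutativeSemiring; sym; *-congˡ; *-congʳ; *-assoc; *-identityʳ)
  open ExpProperties commutativeSemiring using (_^_; ^-assocʳ; ^-congʳ)
  open Scalars R
  open SetoidReasoning (×-setoid setoid setoid)

  infixr 7 _·₂_

  _·₂_ : Carrier → L² R → L² R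
  a ·₂ z = a * proj₁ z , a * proj₂ z

  ·₂-congˡ : ∀ {a b} z → a ≈ b → _≈₂_ R (a ·₂ z) (b ·₂ z)
  ·₂-congˡ z a≈b = *-congʳ a≈b , *-congʳ a≈b

  ·₂-congʳ : ∀ a {z w} → _≈₂_ R z w → _≈₂_ R (a ·₂ z) (a ·₂ w)
  ·₂-congʳ a (x≈x′ , y≈y′) = *-congˡ x≈x′ , *-congˡ y≈y′

  ·₂-assoc : ∀ a b z → _≈₂_ R ((a * b) ·₂ z) (a ·₂ b ·₂ z)
  ·₂-assoc a b z = *-assoc a b (proj₁ z) , *-assoc a b (proj₂ z)

  liftMap-cong : ∀ {d} (F₁ F₂ : HForm R d) {z w} → _≈₂_ R z w →
    _≈₂_ R (liftMap R F₁ F₂ z) (liftMap R F₁ F₂ w)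
  liftMap-cong F₁ F₂ (x≈x′ , y≈y′) = evalH-cong F₁ x≈x′ y≈y′ , evalH-cong F₂ x≈x′ y≈y′

  liftMap-homogeneous : ∀ {d} (F₁ F₂ : HForm R d) a z →
    _≈₂_ R (liftMap R F₁ F₂ (a ·₂ z)) (a ^ d ·₂ liftMap R F₁ F₂ z)
  liftMap-homogeneous F₁ F₂ a (x , y) =
    evalH-homogeneous F₁ a x y , evalH-homogeneous F₂ a x y

  iter-liftMap-homogeneous : ∀ {d} (F₁ F₂ : HForm R d) a z j →
    let Fʲ = iter R (liftMap R F₁ F₂) j in
    _≈₂_ R (Fʲ (a ·₂ z)) (a ^ (d ℕ.^ j) ·₂ Fʲ z)
  iter-liftMap-homogeneous F₁ F₂ a z zero = ·₂-congˡ z (sym (*-identityʳ a))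
  iter-liftMap-homogeneous {d} F₁ F₂ a z (suc j) = begin
    F (Fʲ (a ·₂ z))            ≈⟨ liftMap-cong F₁ F₂ (iter-liftMap-homogeneous F₁ F₂ a z j) ⟩
    F (A ·₂ Fʲ z)              ≈⟨ liftMap-homogeneous F₁ F₂ A (Fʲ z) ⟩
    A ^ d ·₂ F (Fʲ z)          ≈⟨ ·₂-congˡ (F (Fʲ z)) (^-assocʳ a (d ℕ.^ j) d) ⟩
    a ^ (d ℕ.^ j ℕ.* d) ·₂ F (Fʲ z) ≈⟨ ·₂-congˡ (F (Fʲ z)) (^-congʳ a (ℕₚ.*-comm (d ℕ.^ j) d)) ⟩
    a ^ (d ℕ.^ suc j) ·₂ F (Fʲ z) ∎
    where
    F = liftMap R F₁ F₂
    Fʲ = iter R F j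
    A = a ^ (d ℕ.^ j)

  rescaled-orbit-collision : ∀ {d} (F₁ F₂ : HForm R d) z m n t r →
    let iterF = iter R (liftMap R F₁ F₂) in
    _≈₂_ R (iterF n z) (t ·₂ iterF m z) → r ^ (d ℕ.^ m) ≈ r ^ (d ℕ.^ n) * t →
    _≈₂_ R (iterF m (r ·₂ z)) (iterF n (r ·₂ z))
  rescaled-orbit-collision {d} F₁ F₂ z m n t r Fⁿz≈tFᵐz rᵐ≈rⁿt = begin
    iterF m (r ·₂ z)             ≈⟨ iter-liftMap-homogeneous F₁ F₂ r z m ⟩
    r ^ (d ℕ.^ m) ·₂ iterF m z    ≈⟨ ·₂-congˡ (iterF m z) rᵐ≈rⁿt ⟩
    (r ^ (d ℕ.^ n) * t) ·₂ iterF m z ≈⟨ ·₂-assoc (r ^ (d ℕ.^ n)) t (iterF m z) ⟩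
    r ^ (d ℕ.^ n) ·₂ t ·₂ iterF m z ≈⟨ ·₂-congʳ (r ^ (d ℕ.^ n)) Fⁿz≈tFᵐz ⟨
    r ^ (d ℕ.^ n) ·₂ iterF n z    ≈⟨ iter-liftMap-homogeneous F₁ F₂ r z n ⟨
    iterF n (r ·₂ z) ∎
    where
    iterF = iter R (liftMap R F₁ F₂)

  unit-·₂-NonZero₂ : ∀ {a b z} → a * b ≈ 1# → NonZero₂ R z → NonZero₂ R (a ·₂ z)
  unit-·₂-NonZero₂ ab≈1 z≢0 (ax≈0 , ay≈0) = z≢0 (unit-cancel ab≈1 ax≈0 , unit-cancel ab≈1 ay≈0)

open Scalars
open Points

lemma3p17 : ∀ {c ℓ : Level} (L : CommutativeRing c ℓ) → IsField L → IsAlgClosed L →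
    (d : ℕ) → 2 ≤ d → (F₁ F₂ : HForm L d) → NoCommonLinearFactor L F₁ F₂ →
    ∀ (z : L² L) → NonZero₂ L z → PreperiodicP¹ L F₁ F₂ z →
    Σ (L² L) λ w → NonZero₂ L w × PreperiodicLift L F₁ F₂ w × _∼ₚ_ L z w
lemma3p17 L isField closed d 2≤d F₁ F₂ _ z z≢0 (m , n , m<n , t , t≉0 , Fⁿz≈tFᵐz)
  with k , dᵐ+1+k≡dⁿ ← ℕₚ.m≤n⇒∃[o]m+o≡n (ℕₚ.^-monoʳ-< d 2≤d m<n)
  with r , rᵏ⁺¹t≈1 ← ∃-root-of-inverse L closed k t≉0 =
  _·₂_ L r z , unit-·₂-NonZero₂ L r·rᵏt≈1 z≢0 ,
  (m , n , m<n , rescaled-orbit-collision L F₁ F₂ z m n t r Fⁿz≈tFᵐz rᵈᵐ≈rᵈⁿt) ,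
  (r , unit-≉0 L (IsField.0≉1 isField) r·rᵏt≈1 , refl , refl)
  where
  open CommutativeRing L using (_≈_; _*_; 1#; refl; sym; trans; *-assoc; commutativeSemiring)
  open ExpProperties commutativeSemiring using (_^_)
  r·rᵏt≈1 : r * (r ^ k * t) ≈ 1#
  r·rᵏt≈1 = trans (sym (*-assoc r (r ^ k) t)) rᵏ⁺¹t≈1
  rᵈᵐ≈rᵈⁿt : r ^ (d ℕ.^ m) ≈ r ^ (d ℕ.^ n) * t
  rᵈᵐ≈rᵈⁿt = ^-shift L r t (d ℕ.^ m) (suc k) (≡-trans (ℕₚ.+-suc (d ℕ.^ m) k) dᵐ+1+k≡dⁿ) rᵏ⁺¹t≈1
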